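{- Let $A=\begin{pmatrix}a&b\\c&d\end{pmatrix}\in SL_2(\mathbb Z)$ be hyperbolic with $A\equiv I\bmod2$, and let $N$ be a prime not dividing $(\operatorname{tr}A)^2-4$. Let $g\in\mathcal C_A(N)$ with $g\not\equiv\pm I\bmod N$. Then the quadratic form $x\mapsto q(x;g)$ on $(\mathbb Z/N\mathbb Z)^2$ is a nonzero multiple of $Q$, i.e. there is $c\in(\mathbb Z/N\mathbb Z)^\times$ with $q(x;g)=cQ(x)$ for all $x\in(\mathbb Z/N\mathbb Z)^2$.
   Context: $\omega(x,y)=x_1y_2-x_2y_1$; vectors are row vectors. $Q(x)=\omega(x,xA)=bx_1^2+(d-a)x_1x_2-cx_2^2$, considered modulo $N$. $\mathcal C_A(N)$ is the centralizer of $A$ in $SL_2(\mathbb Z/N\mathbb Z)$; for $g\in\mathcal C_A(N)$ with $g\ne I$ the matrix $g-I$ is invertible over $\mathbb Z/N\mathbb Z$, and one defines $q(x;g)=\omega\big(x(g-I)^{ -1},\,x(g-I)^{ -1}g\big)$. -}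

module Defs where

open import Data.Nat using (ℕ; _<_)
open import Relation.Binary.PropositionalEquality using (_≡_)
open import Data.Integer using (ℤ; +_; _+_; _-_; _*_; -_; 0ℤ; 1ℤ; ∣_∣)
open import Data.Integer.Divisibility using (_∣_)
open import Data.Product using (_×_)
open import Relation.Nullary using (¬_)

_≡_[mod_] : ℤ → ℤ → ℕ → Set
x ≡ y [mod N ] = (+ N) ∣ (x - y)

record M2 : Set where
  constructor mat
  field
    m11 m12 m21 m22 : ℤ
open M2 public

record V2 : Set where
  constructor vec
  field
    v1 v2 : ℤ
open V2 public

I₂ : M2
I₂ = mat 1ℤ 0ℤ 0ℤ 1ℤ

negM : M2 → M2
negM (mat a b c d) = mat (- a) (- b) (- c) (- d)

_-M_ : M2 → M2 → M2
mat a b c d -M mat a' b' c' d' = mat (a - a') (b - b') (c - c') (d - d')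

_*M_ : M2 → M2 → M2
mat a b c d *M mat a' b' c' d' =
  mat (a * a' + b * c') (a * b' + b * d') (c * a' + d * c') (c * b' + d * d')

det : M2 → ℤ
det (mat a b c d) = a * d - b * c

tr : M2 → ℤ
tr (mat a b c d) = a + d

_·M_ : V2 → M2 → V2
vec x1 x2 ·M mat a b c d = vec (x1 * a + x2 * c) (x1 * b + x2 * d)

ω : V2 → V2 → ℤ
ω (vec x1 x2) (vec y1 y2) = x1 * y2 - x2 * y1

_≡M_[mod_] : M2 → M2 → ℕ → Set
M ≡M M' [mod N ] =
  (m11 M ≡ m11 M' [mod N ]) × (m12 M ≡ m12 M' [mod N ]) ×
  (m21 M ≡ m21 M' [mod N ]) × (m22 M ≡ m22 M' [mod N ])

-- Q(x) = ω(x, xA) = b x1² + (d-a) x1 x2 - c x2²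
Q : M2 → V2 → ℤ
Q A x = ω x (x ·M A)

InSL2ℤ : M2 → Set
InSL2ℤ A = det A ≡ 1ℤ

Hyperbolic : M2 → Set
Hyperbolic A = 2 < ∣ tr A ∣

-- g ∈ 𝒞_A(N): g ∈ SL₂(ℤ/Nℤ) (represented by an integer matrix) commuting with A mod N
InCentralizer : M2 → ℕ → M2 → Set
InCentralizer A N g = (det g ≡ 1ℤ [mod N ]) × ((g *M A) ≡M (A *M g) [mod N ])

IsInvMod : ℕ → M2 → M2 → Set
IsInvMod N M h = ((h *M M) ≡M I₂ [mod N ]) × ((M *M h) ≡M I₂ [mod N ])

-- q(x; g) = ω(x (g-I)⁻¹, x (g-I)⁻¹ g), computed with a chosen representative h of (g-I)⁻¹
q : M2 → M2 → V2 → ℤ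
q h g x = ω (x ·M h) ((x ·M h) ·M g)

-- Since N ∤ (tr A)² − 4, A is not scalar mod N, so a matrix g commuting with A mod N has
-- off-diagonal entries and diagonal difference proportional to those of A, i.e. g ≡ αI + βA.
-- For such g, ω(y, yg) = β Q(y).  A matrix M commuting with A satisfies Q(yM) = det M · Q(y),
-- because ω(yM, yAM) = det M · ω(y, yA); with M = g − I and y = x(g − I)⁻¹ this turns
-- q(x; g) = β Q(y) into β det((g − I)⁻¹) Q(x).  Finally β ≢ 0: otherwise g ≡ αI with
-- α² ≡ det g ≡ 1, so g ≡ ±I.

module Submission where

open import Defs
open import Data.Nat using (ℕ)
open import Data.Nat.Primality using (Prime)
open import Data.Integer using (ℤ; +_; _*_; _-_; _+_)
open import Data.Integer.Divisibility using (_∣_)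
open import Data.Product using (_×_; ∃)
open import Relation.Nullary using (¬_)

import Data.Nat as ℕ
import Data.Nat.Divisibility as ℕᵈ
open import Data.Nat.Primality using (euclidsLemma; prime⇒irreducible; ¬prime[1])
open import Data.Nat.Coprimality using (Coprime; coprime-Bézout)
open import Data.Nat.GCD using (module Bézout)
open import Data.Integer using (-_; 0ℤ; 1ℤ; ∣_∣; -[1+_])
import Data.Integer.Divisibility.Signed as Signed
open Signed using () renaming (_∣_ to _∣ˢ_)
open import Data.Integer.Properties
  using (abs-*; pos-*; +-identityʳ; *-identityˡ; *-identityʳ; *-assoc; *-comm; neg-distribˡ-*)
open import Data.Integer.Tactic.RingSolver using (solve; solve-∀)
open import Data.List using ([]; _∷_)
open import Data.Product using (_,_)
open import Data.Sum using (_⊎_; inj₁; inj₂; [_,_])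
import Data.Sum as Sum
open import Function using (_∘_)
open import Data.Empty using (⊥-elim)
open import Relation.Nullary using (Dec; yes; no)
open import Relation.Nullary.Decidable using (map′)
open import Relation.Binary.Bundles using (Setoid)
open import Relation.Binary.PropositionalEquality
  using (_≡_; refl; sym; cong; cong₂; subst; module ≡-Reasoning)
import Relation.Binary.Reasoning.Setoid as SetoidReasoning

infixl 6 _+M_
infixr 7 _•M_

scalar : ℤ → M2
scalar α = mat α 0ℤ 0ℤ α

_•M_ : ℤ → M2 → M2
k •M mat a b c d = mat (k * a) (k * b) (k * c) (k * d)

_+M_ : M2 → M2 → M2
mat a b c d +M mat a' b' c' d' = mat (a + a') (b + b') (c + c') (d + d')

·M-identityʳ : ∀ x → x ·M I₂ ≡ x
·M-identityʳ (vec x₁ x₂) = cong₂ vec (first x₁ x₂) (second x₁ x₂)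
  where
  first : ∀ x₁ x₂ → x₁ * 1ℤ + x₂ * 0ℤ ≡ x₁
  first = solve-∀
  second : ∀ x₁ x₂ → x₁ * 0ℤ + x₂ * 1ℤ ≡ x₂
  second = solve-∀

·M-assoc : ∀ x M M' → (x ·M M) ·M M' ≡ x ·M (M *M M')
·M-assoc (vec x₁ x₂) (mat a b c d) (mat a' b' c' d') =
  cong₂ vec (entry x₁ x₂ a b c d a' c') (entry x₁ x₂ a b c d b' d')
  where
  entry : ∀ x₁ x₂ a b c d e f →
    (x₁ * a + x₂ * c) * e + (x₁ * b + x₂ * d) * f ≡ x₁ * (a * e + b * f) + x₂ * (c * e + d * f)
  entry = solve-∀

det-*M : ∀ M M' → det (M *M M') ≡ det M * det M'
det-*M (mat a b c d) (mat a' b' c' d') = identity a b c d a' b' c' d'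
  where
  identity : ∀ a b c d a' b' c' d' →
    (a * a' + b * c') * (c * b' + d * d') - (a * b' + b * d') * (c * a' + d * c')
      ≡ (a * d - b * c) * (a' * d' - b' * c')
  identity = solve-∀

ω-·M : ∀ x y M → ω (x ·M M) (y ·M M) ≡ det M * ω x y
ω-·M (vec x₁ x₂) (vec y₁ y₂) (mat a b c d) = identity x₁ x₂ y₁ y₂ a b c d
  where
  identity : ∀ x₁ x₂ y₁ y₂ a b c d →
    (x₁ * a + x₂ * c) * (y₁ * b + y₂ * d) - (x₁ * b + x₂ * d) * (y₁ * a + y₂ * c)
      ≡ (a * d - b * c) * (x₁ * y₂ - x₂ * y₁)
  identity = solve-∀

ω-·M-pencil : ∀ α β A x → ω x (x ·M (scalar α +M β •M A)) ≡ β * Q A x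
ω-·M-pencil α β (mat a b c d) (vec x₁ x₂) = identity α β a b c d x₁ x₂
  where
  identity : ∀ α β a b c d x₁ x₂ →
    x₁ * (x₁ * (0ℤ + β * b) + x₂ * (α + β * d)) - x₂ * (x₁ * (α + β * a) + x₂ * (0ℤ + β * c))
      ≡ β * (x₁ * (x₁ * b + x₂ * d) - x₂ * (x₁ * a + x₂ * c))
  identity = solve-∀

module Congruence (N : ℕ) where

  infix 4 _≈_ _≉_ _≈V_ _≈M_

  -- Records rather than the congruences of Defs, so that unification recovers both sides.
  record _≈_ (x y : ℤ) : Set where
    constructor divides-difference
    field difference-divisible : + N ∣ˢ (x - y)

  _≉_ : ℤ → ℤ → Set
  x ≉ y = ¬ (x ≈ y)

  record _≈V_ (x y : V2) : Set where
    constructor componentwise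
    field
      ≈-v1 : v1 x ≈ v1 y
      ≈-v2 : v2 x ≈ v2 y

  record _≈M_ (M M' : M2) : Set where
    constructor entrywise
    field
      ≈-m11 : m11 M ≈ m11 M'
      ≈-m12 : m12 M ≈ m12 M'
      ≈-m21 : m21 M ≈ m21 M'
      ≈-m22 : m22 M ≈ m22 M'

  private
    ∣ˢ-+ : ∀ {u v w} → + N ∣ˢ u → + N ∣ˢ v → w ≡ u + v → + N ∣ˢ w
    ∣ˢ-+ p q e = subst (+ N ∣ˢ_) (sym e) (Signed.∣m∣n⇒∣m+n p q)

    ∣ˢ-* : ∀ {u w} k → + N ∣ˢ u → w ≡ k * u → + N ∣ˢ w
    ∣ˢ-* k p e = subst (+ N ∣ˢ_) (sym e) (Signed.∣n⇒∣m*n k p)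

  ≈-by-difference : ∀ {x y x' y'} → x - y ≡ x' - y' → x' ≈ y' → x ≈ y
  ≈-by-difference e (divides-difference p) = divides-difference (subst (+ N ∣ˢ_) (sym e) p)

  ≈-refl : ∀ {x} → x ≈ x
  ≈-refl {x} = divides-difference (Signed.divides 0ℤ (solve (x ∷ [])))

  ≡⇒≈ : ∀ {x y} → x ≡ y → x ≈ y
  ≡⇒≈ refl = ≈-refl

  ≈-sym : ∀ {x y} → x ≈ y → y ≈ x
  ≈-sym {x} {y} (divides-difference p) = divides-difference (∣ˢ-* (- 1ℤ) p (solve (x ∷ y ∷ [])))

  ≈-trans : ∀ {x y z} → x ≈ y → y ≈ z → x ≈ z
  ≈-trans {x} {y} {z} (divides-difference p) (divides-difference q) =
    divides-difference (∣ˢ-+ p q (solve (x ∷ y ∷ z ∷ [])))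

  +-cong : ∀ {x y u v} → x ≈ y → u ≈ v → x + u ≈ y + v
  +-cong {x} {y} {u} {v} (divides-difference p) (divides-difference q) =
    divides-difference (∣ˢ-+ p q (solve (x ∷ y ∷ u ∷ v ∷ [])))

  -‿cong : ∀ {x y} → x ≈ y → - x ≈ - y
  -‿cong {x} {y} (divides-difference p) = divides-difference (∣ˢ-* (- 1ℤ) p (solve (x ∷ y ∷ [])))

  *-cong : ∀ {x y u v} → x ≈ y → u ≈ v → x * u ≈ y * v
  *-cong {x} {y} {u} {v} (divides-difference p) (divides-difference q) = divides-difference
    (∣ˢ-+ (∣ˢ-* u p refl) (∣ˢ-* y q refl) (solve (x ∷ y ∷ u ∷ v ∷ [])))

  *-congˡ : ∀ x {u v} → u ≈ v → x * u ≈ x * v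
  *-congˡ x = *-cong (≈-refl {x})

  *-congʳ : ∀ u {x y} → x ≈ y → x * u ≈ y * u
  *-congʳ u p = *-cong p (≈-refl {u})

  ≈-setoid : Setoid _ _
  ≈-setoid = record
    { Carrier = ℤ
    ; _≈_ = _≈_
    ; isEquivalence = record { refl = ≈-refl ; sym = ≈-sym ; trans = ≈-trans }
    }

  module ≈-Reasoning = SetoidReasoning ≈-setoid

  ≈⇒≡[mod] : ∀ {x y} → x ≈ y → x ≡ y [mod N ]
  ≈⇒≡[mod] (divides-difference p) = Signed.∣⇒∣ᵤ p

  ≡[mod]⇒≈ : ∀ {x y} → x ≡ y [mod N ] → x ≈ y
  ≡[mod]⇒≈ p = divides-difference (Signed.∣ᵤ⇒∣ p)

  ≈M⇒≡M[mod] : ∀ {M M'} → M ≈M M' → M ≡M M' [mod N ]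
  ≈M⇒≡M[mod] (entrywise p₁₁ p₁₂ p₂₁ p₂₂) =
    ≈⇒≡[mod] p₁₁ , ≈⇒≡[mod] p₁₂ , ≈⇒≡[mod] p₂₁ , ≈⇒≡[mod] p₂₂

  ≡M[mod]⇒≈M : ∀ {M M'} → M ≡M M' [mod N ] → M ≈M M'
  ≡M[mod]⇒≈M (p₁₁ , p₁₂ , p₂₁ , p₂₂) =
    entrywise (≡[mod]⇒≈ p₁₁) (≡[mod]⇒≈ p₁₂) (≡[mod]⇒≈ p₂₁) (≡[mod]⇒≈ p₂₂)

  ∣⇒≈0 : ∀ x → + N ∣ x → x ≈ 0ℤ
  ∣⇒≈0 x p = divides-difference (subst (+ N ∣ˢ_) (sym (+-identityʳ x)) (Signed.∣ᵤ⇒∣ p))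

  ≈0⇒∣ : ∀ x → x ≈ 0ℤ → + N ∣ x
  ≈0⇒∣ x (divides-difference p) = Signed.∣⇒∣ᵤ (subst (+ N ∣ˢ_) (+-identityʳ x) p)

  ≈0? : ∀ x → Dec (x ≈ 0ℤ)
  ≈0? x = map′ (∣⇒≈0 x) (≈0⇒∣ x) (N ℕᵈ.∣? ∣ x ∣)

  ≈0⇒≈ : ∀ {x y} → x - y ≈ 0ℤ → x ≈ y
  ≈0⇒≈ {x} {y} = ≈-by-difference (sym (+-identityʳ (x - y)))

  ≈V-refl : ∀ {x} → x ≈V x
  ≈V-refl {x} = componentwise (≈-refl {v1 x}) (≈-refl {v2 x})

  ≈M-refl : ∀ {M} → M ≈M M
  ≈M-refl {M} = entrywise (≈-refl {m11 M}) (≈-refl {m12 M}) (≈-refl {m21 M}) (≈-refl {m22 M})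

  ≈M-trans : ∀ {M M' M''} → M ≈M M' → M' ≈M M'' → M ≈M M''
  ≈M-trans (entrywise p₁₁ p₁₂ p₂₁ p₂₂) (entrywise q₁₁ q₁₂ q₂₁ q₂₂) =
    entrywise (≈-trans p₁₁ q₁₁) (≈-trans p₁₂ q₁₂) (≈-trans p₂₁ q₂₁) (≈-trans p₂₂ q₂₂)

  ·M-cong : ∀ {x x' M M'} → x ≈V x' → M ≈M M' → x ·M M ≈V x' ·M M'
  ·M-cong (componentwise p₁ p₂) (entrywise q₁₁ q₁₂ q₂₁ q₂₂) =
    componentwise (+-cong (*-cong p₁ q₁₁) (*-cong p₂ q₂₁)) (+-cong (*-cong p₁ q₁₂) (*-cong p₂ q₂₂))

  ω-cong : ∀ {x x' y y'} → x ≈V x' → y ≈V y' → ω x y ≈ ω x' y'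
  ω-cong (componentwise p₁ p₂) (componentwise q₁ q₂) = +-cong (*-cong p₁ q₂) (-‿cong (*-cong p₂ q₁))

  ·M-congʳ : ∀ x {M M'} → M ≈M M' → x ·M M ≈V x ·M M'
  ·M-congʳ x = ·M-cong (≈V-refl {x})

  ω-congʳ : ∀ x {y y'} → y ≈V y' → ω x y ≈ ω x y'
  ω-congʳ x = ω-cong (≈V-refl {x})

  Q-cong : ∀ A {x x'} → x ≈V x' → Q A x ≈ Q A x'
  Q-cong A p = ω-cong p (·M-cong p (≈M-refl {A}))

  det-cong : ∀ {M M'} → M ≈M M' → det M ≈ det M'
  det-cong (entrywise p₁₁ p₁₂ p₂₁ p₂₂) = +-cong (*-cong p₁₁ p₂₂) (-‿cong (*-cong p₁₂ p₂₁))

  scalar-cong : ∀ {α α'} → α ≈ α' → scalar α ≈M scalar α'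
  scalar-cong p = entrywise p (≈-refl {0ℤ}) (≈-refl {0ℤ}) p

  open ≈-Reasoning

  record InPencil (A g : M2) : Set where
    field
      α β : ℤ
      ≈pencil : g ≈M (scalar α +M β •M A)

  pencil-scalar-part : ∀ A {α β} → β ≈ 0ℤ → (scalar α +M β •M A) ≈M scalar α
  pencil-scalar-part (mat a b c d) {α} {β} β≈0 = entrywise (vanish α a) (vanish 0ℤ b) (vanish 0ℤ c) (vanish α d)
    where
    vanish : ∀ x y → x + β * y ≈ x
    vanish x y = ≈-trans (+-cong (≈-refl {x}) (*-congʳ y β≈0)) (≡⇒≈ (+-identityʳ x))

  pivot : ∀ u v w → v * w ≈ 1ℤ → ∀ u' v' → u' * v ≈ u * v' → u' ≈ (u * w) * v'
  pivot u v w vw≈1 u' v' cross = begin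
    u'             ≡⟨ sym (*-identityʳ u') ⟩
    u' * 1ℤ        ≈⟨ *-congˡ u' (≈-sym vw≈1) ⟩
    u' * (v * w)   ≡⟨ sym (*-assoc u' v w) ⟩
    (u' * v) * w   ≈⟨ *-congʳ w cross ⟩
    (u * v') * w   ≡⟨ swap u v' w ⟩
    (u * w) * v'   ∎
    where
    swap : ∀ x y z → (x * y) * z ≡ (x * z) * y
    swap = solve-∀

  discriminant≉0⇒non-scalar : ∀ a b c d → a * d - b * c ≡ 1ℤ → (a + d) * (a + d) - + 4 ≉ 0ℤ →
    b ≉ 0ℤ ⊎ c ≉ 0ℤ ⊎ a - d ≉ 0ℤ
  discriminant≉0⇒non-scalar a b c d det≡1 Δ≉0 with ≈0? b | ≈0? c | ≈0? (a - d)
  ... | no b≉0    | _       | _          = inj₁ b≉0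
  ... | yes _     | no c≉0  | _          = inj₂ (inj₁ c≉0)
  ... | yes _     | yes _   | no a-d≉0   = inj₂ (inj₂ a-d≉0)
  ... | yes b≈0   | yes _   | yes a-d≈0  = ⊥-elim (Δ≉0 (begin
    (a + d) * (a + d) - + 4
      ≡⟨ discriminant a b c d ⟩
    (a - d) * (a - d) + + 4 * (b * c) + + 4 * ((a * d - b * c) - 1ℤ)
      ≈⟨ +-cong (+-cong (*-cong a-d≈0 a-d≈0) (*-congˡ (+ 4) (*-congʳ c b≈0)))
                (≡⇒≈ (cong (λ t → + 4 * (t - 1ℤ)) det≡1)) ⟩
    0ℤ * 0ℤ + + 4 * (0ℤ * c) + + 4 * (1ℤ - 1ℤ)
      ≡⟨⟩
    0ℤ ∎))
    where
    discriminant : ∀ a b c d →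
      (a + d) * (a + d) - + 4 ≡ (a - d) * (a - d) + + 4 * (b * c) + + 4 * ((a * d - b * c) - 1ℤ)
    discriminant = solve-∀

  det-inverse : ∀ h M → (h *M M) ≈M I₂ → det h * det M ≈ 1ℤ
  det-inverse h M hM≈I = begin
    det h * det M   ≡⟨ sym (det-*M h M) ⟩
    det (h *M M)    ≈⟨ det-cong hM≈I ⟩
    1ℤ              ∎

  Q-·M-commuting : ∀ A M y → (M *M A) ≈M (A *M M) → Q A (y ·M M) ≈ det M * Q A y
  Q-·M-commuting A M y MA≈AM = begin
    ω (y ·M M) ((y ·M M) ·M A)   ≡⟨ cong (ω (y ·M M)) (·M-assoc y M A) ⟩
    ω (y ·M M) (y ·M (M *M A))   ≈⟨ ω-congʳ (y ·M M) (·M-congʳ y MA≈AM) ⟩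
    ω (y ·M M) (y ·M (A *M M))   ≡⟨ cong (ω (y ·M M)) (sym (·M-assoc y A M)) ⟩
    ω (y ·M M) ((y ·M A) ·M M)   ≡⟨ ω-·M y (y ·M A) M ⟩
    det M * Q A y                ∎

  commuting⇒−I₂-commuting : ∀ A M → (M *M A) ≈M (A *M M) → ((M -M I₂) *M A) ≈M (A *M (M -M I₂))
  commuting⇒−I₂-commuting (mat a b c d) (mat p q r s) (entrywise c₁₁ c₁₂ c₂₁ c₂₂) = entrywise
    (≈-by-difference (entry₁₁ a b c p q r) c₁₁) (≈-by-difference (entry₁₂ a b d p q s) c₁₂)
    (≈-by-difference (entry₂₁ a c d p r s) c₂₁) (≈-by-difference (entry₂₂ b c d q r s) c₂₂)
    where
    entry₁₁ : ∀ a b c p q r →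
      ((p - 1ℤ) * a + (q - 0ℤ) * c) - (a * (p - 1ℤ) + b * (r - 0ℤ)) ≡ (p * a + q * c) - (a * p + b * r)
    entry₁₁ = solve-∀
    entry₁₂ : ∀ a b d p q s →
      ((p - 1ℤ) * b + (q - 0ℤ) * d) - (a * (q - 0ℤ) + b * (s - 1ℤ)) ≡ (p * b + q * d) - (a * q + b * s)
    entry₁₂ = solve-∀
    entry₂₁ : ∀ a c d p r s →
      ((r - 0ℤ) * a + (s - 1ℤ) * c) - (c * (p - 1ℤ) + d * (r - 0ℤ)) ≡ (r * a + s * c) - (c * p + d * r)
    entry₂₁ = solve-∀
    entry₂₂ : ∀ b c d q r s →
      ((r - 0ℤ) * b + (s - 1ℤ) * d) - (c * (q - 0ℤ) + d * (s - 1ℤ)) ≡ (r * b + s * d) - (c * q + d * s)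
    entry₂₂ = solve-∀

  Q-·M-left-inverse : ∀ A M h → (M *M A) ≈M (A *M M) → (h *M M) ≈M I₂ →
    ∀ x → Q A (x ·M h) ≈ det h * Q A x
  Q-·M-left-inverse A M h MA≈AM hM≈I x = begin
    Q A y                              ≡⟨ sym (*-identityˡ (Q A y)) ⟩
    1ℤ * Q A y                         ≈⟨ *-congʳ (Q A y) (≈-sym (det-inverse h M hM≈I)) ⟩
    (det h * det M) * Q A y            ≡⟨ *-assoc (det h) (det M) (Q A y) ⟩
    det h * (det M * Q A y)            ≈⟨ *-congˡ (det h) (≈-sym (Q-·M-commuting A M y MA≈AM)) ⟩
    det h * Q A (y ·M M)               ≡⟨ cong (λ z → det h * Q A z) (·M-assoc x h M) ⟩
    det h * Q A (x ·M (h *M M))        ≈⟨ *-congˡ (det h) (Q-cong A (·M-congʳ x hM≈I)) ⟩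
    det h * Q A (x ·M I₂)              ≡⟨ cong (λ z → det h * Q A z) (·M-identityʳ x) ⟩
    det h * Q A x                      ∎
    where
    y : V2
    y = x ·M h

  q-formula : ∀ {A g} (P : InPencil A g) h → (h *M (g -M I₂)) ≈M I₂ → (g *M A) ≈M (A *M g) →
    ∀ x → q h g x ≈ (InPencil.β P * det h) * Q A x
  q-formula {A} {g} P h h[g-I]≈I gA≈Ag x = begin
    ω y (y ·M g)                      ≈⟨ ω-congʳ y (·M-congʳ y ≈pencil) ⟩
    ω y (y ·M (scalar α +M β •M A))   ≡⟨ ω-·M-pencil α β A y ⟩
    β * Q A y                         ≈⟨ *-congˡ β (Q-·M-left-inverse A (g -M I₂) h
                                           (commuting⇒−I₂-commuting A g gA≈Ag) h[g-I]≈I x) ⟩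
    β * (det h * Q A x)               ≡⟨ sym (*-assoc β (det h) (Q A x)) ⟩
    (β * det h) * Q A x               ∎
    where
    open InPencil P
    y : V2
    y = x ·M h

module PrimeField {N : ℕ} (N-prime : Prime N) where

  open Congruence N

  *≈0⇒≈0⊎≈0 : ∀ x y → x * y ≈ 0ℤ → x ≈ 0ℤ ⊎ y ≈ 0ℤ
  *≈0⇒≈0⊎≈0 x y xy≈0 = Sum.map (∣⇒≈0 x) (∣⇒≈0 y)
    (euclidsLemma ∣ x ∣ ∣ y ∣ N-prime (subst (N ℕᵈ.∣_) (abs-* x y) (≈0⇒∣ (x * y) xy≈0)))

  *-≉0 : ∀ x y → x ≉ 0ℤ → y ≉ 0ℤ → x * y ≉ 0ℤ
  *-≉0 x y x≉0 y≉0 = [ x≉0 , y≉0 ] ∘ *≈0⇒≈0⊎≈0 x y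

  1≉0 : 1ℤ ≉ 0ℤ
  1≉0 1≈0 = ¬prime[1] (subst Prime (ℕᵈ.∣1⇒≡1 (≈0⇒∣ 1ℤ 1≈0)) N-prime)

  *≈1⇒≉0 : ∀ x y → x * y ≈ 1ℤ → x ≉ 0ℤ
  *≈1⇒≉0 x y xy≈1 x≈0 = 1≉0 (begin
    1ℤ      ≈⟨ ≈-sym xy≈1 ⟩
    x * y   ≈⟨ *-congʳ y x≈0 ⟩
    0ℤ * y  ≡⟨⟩
    0ℤ      ∎)
    where open ≈-Reasoning

  *-self≈1⇒≈±1 : ∀ x → x * x ≈ 1ℤ → x ≈ 1ℤ ⊎ x ≈ - 1ℤ
  *-self≈1⇒≈±1 x x²≈1 =
    Sum.map ≈0⇒≈ ≈0⇒≈ (*≈0⇒≈0⊎≈0 (x - 1ℤ) (x - - 1ℤ) (≈-by-difference (factor x) x²≈1))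
    where
    factor : ∀ x → (x - 1ℤ) * (x - - 1ℤ) - 0ℤ ≡ x * x - 1ℤ
    factor = solve-∀

  ∤⇒coprime : ∀ {m} → ¬ (N ℕᵈ.∣ m) → Coprime N m
  ∤⇒coprime ∤m (d∣N , d∣m) with prime⇒irreducible N-prime d∣N
  ... | inj₁ d≡1  = d≡1
  ... | inj₂ refl = ⊥-elim (∤m d∣m)

  Bézout-toℤ : ∀ a b c d → 1 ℕ.+ a ℕ.* b ≡ c ℕ.* d → 1ℤ + + a * + b ≡ + c * + d
  Bézout-toℤ a b c d eq = begin
    1ℤ + + a * + b      ≡⟨ cong (λ t → 1ℤ + t) (sym (pos-* a b)) ⟩
    + (1 ℕ.+ a ℕ.* b)   ≡⟨ cong +_ eq ⟩
    + (c ℕ.* d)         ≡⟨ pos-* c d ⟩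
    + c * + d           ∎
    where open ≡-Reasoning

  Bézout⇒invertible : ∀ {m} → Bézout.Identity 1 N m → ∃ λ w → + m * w ≈ 1ℤ
  Bézout⇒invertible {m} (Bézout.+- u v eq) =
    - + v , divides-difference (Signed.divides (- + u) (begin
      + m * - + v - 1ℤ    ≡⟨ rearrange (+ m) (+ v) ⟩
      - (1ℤ + + v * + m)  ≡⟨ cong -_ (Bézout-toℤ v m u N eq) ⟩
      - (+ u * + N)       ≡⟨ neg-distribˡ-* (+ u) (+ N) ⟩
      - + u * + N         ∎))
    where
    open ≡-Reasoning
    rearrange : ∀ m v → m * - v - 1ℤ ≡ - (1ℤ + v * m)
    rearrange = solve-∀
  Bézout⇒invertible {m} (Bézout.-+ u v eq) =
    + v , divides-difference (Signed.divides (+ u) (begin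
      + m * + v - 1ℤ                ≡⟨ cong (_- 1ℤ) (*-comm (+ m) (+ v)) ⟩
      + v * + m - 1ℤ                ≡⟨ cong (_- 1ℤ) (sym (Bézout-toℤ u N v m eq)) ⟩
      (1ℤ + + u * + N) - 1ℤ         ≡⟨ cancel (+ u * + N) ⟩
      + u * + N                     ∎))
    where
    open ≡-Reasoning
    cancel : ∀ x → (1ℤ + x) - 1ℤ ≡ x
    cancel = solve-∀

  ≉0⇒invertible : ∀ x → x ≉ 0ℤ → ∃ λ w → x * w ≈ 1ℤ
  ≉0⇒invertible (+ m) x≉0 = Bézout⇒invertible (coprime-Bézout (∤⇒coprime (x≉0 ∘ ∣⇒≈0 (+ m))))
  ≉0⇒invertible -[1+ m ] x≉0
    with Bézout⇒invertible (coprime-Bézout (∤⇒coprime (x≉0 ∘ ∣⇒≈0 -[1+ m ])))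
  ... | w , mw≈1 = - w , ≈-by-difference (negate-both (+ ℕ.suc m) w) mw≈1
    where
    negate-both : ∀ x w → (- x) * (- w) - 1ℤ ≡ x * w - 1ℤ
    negate-both = solve-∀

  cross≈0⇒multiple : ∀ u₁ u₂ u₃ v₁ v₂ v₃ →
    u₁ * v₂ ≈ u₂ * v₁ → u₁ * v₃ ≈ u₃ * v₁ → u₂ * v₃ ≈ u₃ * v₂ →
    v₁ ≉ 0ℤ ⊎ v₂ ≉ 0ℤ ⊎ v₃ ≉ 0ℤ →
    ∃ λ β → u₁ ≈ β * v₁ × u₂ ≈ β * v₂ × u₃ ≈ β * v₃
  cross≈0⇒multiple u₁ u₂ u₃ v₁ v₂ v₃ c₁₂ c₁₃ c₂₃ (inj₁ v₁≉0)
    with ≉0⇒invertible v₁ v₁≉0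
  ... | w , v₁w≈1 = u₁ * w , pivot u₁ v₁ w v₁w≈1 u₁ v₁ ≈-refl
                           , pivot u₁ v₁ w v₁w≈1 u₂ v₂ (≈-sym c₁₂)
                           , pivot u₁ v₁ w v₁w≈1 u₃ v₃ (≈-sym c₁₃)
  cross≈0⇒multiple u₁ u₂ u₃ v₁ v₂ v₃ c₁₂ c₁₃ c₂₃ (inj₂ (inj₁ v₂≉0))
    with ≉0⇒invertible v₂ v₂≉0
  ... | w , v₂w≈1 = u₂ * w , pivot u₂ v₂ w v₂w≈1 u₁ v₁ c₁₂
                           , pivot u₂ v₂ w v₂w≈1 u₂ v₂ ≈-refl
                           , pivot u₂ v₂ w v₂w≈1 u₃ v₃ (≈-sym c₂₃)
  cross≈0⇒multiple u₁ u₂ u₃ v₁ v₂ v₃ c₁₂ c₁₃ c₂₃ (inj₂ (inj₂ v₃≉0))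
    with ≉0⇒invertible v₃ v₃≉0
  ... | w , v₃w≈1 = u₃ * w , pivot u₃ v₃ w v₃w≈1 u₁ v₁ c₁₃
                           , pivot u₃ v₃ w v₃w≈1 u₂ v₂ c₂₃
                           , pivot u₃ v₃ w v₃w≈1 u₃ v₃ ≈-refl

  commuting⇒pencil : ∀ A g → det A ≡ 1ℤ → tr A * tr A - + 4 ≉ 0ℤ → (g *M A) ≈M (A *M g) → InPencil A g
  commuting⇒pencil (mat a b c d) (mat p q r s) det≡1 Δ≉0 (entrywise c₁₁ c₁₂ c₂₁ _) =
    from-multiple (cross≈0⇒multiple q r (p - s) b c (a - d)
      (≈-by-difference (cross₁₁ a b c p q r) c₁₁)
      (≈-by-difference (cross₁₂ a b d p q s) (≈-sym c₁₂))
      (≈-by-difference (cross₂₁ a c d p r s) c₂₁)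
      (discriminant≉0⇒non-scalar a b c d det≡1 Δ≉0))
    where
    cross₁₁ : ∀ a b c p q r → q * c - r * b ≡ (p * a + q * c) - (a * p + b * r)
    cross₁₁ = solve-∀
    cross₁₂ : ∀ a b d p q s → q * (a - d) - (p - s) * b ≡ (a * q + b * s) - (p * b + q * d)
    cross₁₂ = solve-∀
    cross₂₁ : ∀ a c d p r s → r * (a - d) - (p - s) * c ≡ (r * a + s * c) - (c * p + d * r)
    cross₂₁ = solve-∀
    diagonal : ∀ x y → x ≡ (x - y) + y
    diagonal = solve-∀
    off-diagonal : ∀ x y → x - (0ℤ + y) ≡ x - y
    off-diagonal = solve-∀
    lower-right : ∀ a d p s β → s - ((p - β * a) + β * d) ≡ β * (a - d) - (p - s)
    lower-right = solve-∀
    from-multiple : (∃ λ β → q ≈ β * b × r ≈ β * c × p - s ≈ β * (a - d)) →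
      InPencil (mat a b c d) (mat p q r s)
    from-multiple (β , q≈βb , r≈βc , p-s≈β[a-d]) = record
      { α = p - β * a
      ; β = β
      ; ≈pencil = entrywise (≡⇒≈ (diagonal p (β * a)))
                            (≈-by-difference (off-diagonal q (β * b)) q≈βb)
                            (≈-by-difference (off-diagonal r (β * c)) r≈βc)
                            (≈-by-difference (lower-right a d p s β) (≈-sym p-s≈β[a-d]))
      }

  scalar-∈SL₂⇒±I : ∀ M α → M ≈M scalar α → det M ≈ 1ℤ → M ≈M I₂ ⊎ M ≈M negM I₂
  scalar-∈SL₂⇒±I M α M≈α det≈1 =
    Sum.map (≈M-trans M≈α ∘ scalar-cong) (≈M-trans M≈α ∘ scalar-cong) (*-self≈1⇒≈±1 α α²≈1)
    where
    open ≈-Reasoning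
    α²≈1 : α * α ≈ 1ℤ
    α²≈1 = begin
      α * α           ≡⟨ sym (+-identityʳ (α * α)) ⟩
      det (scalar α)  ≈⟨ ≈-sym (det-cong M≈α) ⟩
      det M           ≈⟨ det≈1 ⟩
      1ℤ              ∎

  pencil-coefficient-≉0 : ∀ {A g} (P : InPencil A g) → det g ≈ 1ℤ →
    ¬ (g ≈M I₂) → ¬ (g ≈M negM I₂) → InPencil.β P ≉ 0ℤ
  pencil-coefficient-≉0 {A} {g} P det≈1 g≉I g≉-I β≈0 =
    [ g≉I , g≉-I ] (scalar-∈SL₂⇒±I g α (≈M-trans ≈pencil (pencil-scalar-part A β≈0)) det≈1)
    where open InPencil P

lemma2p2 : (A : M2) → InSL2ℤ A → Hyperbolic A → A ≡M I₂ [mod 2 ] →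
    (N : ℕ) → Prime N → ¬ ((+ N) ∣ (tr A * tr A - + 4)) →
    (g : M2) → InCentralizer A N g →
    ¬ (g ≡M I₂ [mod N ]) → ¬ (g ≡M negM I₂ [mod N ]) →
    (h : M2) → IsInvMod N (g -M I₂) h →
    ∃ λ (c : ℤ) → ¬ ((+ N) ∣ c) × ((x : V2) → q h g x ≡ c * Q A x [mod N ])
lemma2p2 A det≡1 _ _ N N-prime Δ≢0 g (det-g≡1 , gA≡Ag) g≢I g≢-I h (h[g-I]≡I , _) =
  conclude (commuting⇒pencil A g det≡1 (Δ≢0 ∘ ≈0⇒∣ _) gA≈Ag)
  where
  open Congruence N
  open PrimeField N-prime

  gA≈Ag : (g *M A) ≈M (A *M g)
  gA≈Ag = ≡M[mod]⇒≈M gA≡Ag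

  h[g-I]≈I : (h *M (g -M I₂)) ≈M I₂
  h[g-I]≈I = ≡M[mod]⇒≈M h[g-I]≡I

  conclude : InPencil A g → ∃ λ (c : ℤ) → ¬ ((+ N) ∣ c) × ((x : V2) → q h g x ≡ c * Q A x [mod N ])
  conclude P = β * det h , c≉0 ∘ ∣⇒≈0 (β * det h) , ≈⇒≡[mod] ∘ q-formula P h h[g-I]≈I gA≈Ag
    where
    open InPencil P
    c≉0 : β * det h ≉ 0ℤ
    c≉0 = *-≉0 β (det h)
      (pencil-coefficient-≉0 P (≡[mod]⇒≈ det-g≡1) (g≢I ∘ ≈M⇒≡M[mod]) (g≢-I ∘ ≈M⇒≡M[mod]))
      (*≈1⇒≉0 (det h) (det (g -M I₂)) (det-inverse h (g -M I₂) h[g-I]≈I))
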